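{- Let $q$ be a prime power and let $1\le i<h$ with $(h-i)\mid h$. Let $L$ denote the relative trace from $\mathbb{F}_{q^h}$ to $\mathbb{F}_{q^{h-i}}$ and let $n$ be an integer with $\gcd(h-i,n)=1$. Then the point set $\mathcal{C}=\{\langle(L(x)^{q^n},x)\rangle_{\mathbb{F}_{q^h}}: x\in\mathbb{F}_{q^h}^*\}$ is an $\mathbb{F}_q$-linear $i$-club of rank $h$ in $\mathrm{PG}(1,q^h)$.
   Context: An $\mathbb{F}_q$-linear set of rank $k$ in $\mathrm{PG}(1,q^h)$ is the set of points $\{\langle w\rangle_{\mathbb{F}_{q^h}}: w\in W\setminus\{0\}\}$ for some $k$-dimensional $\mathbb{F}_q$-subspace $W$ of $\mathbb{F}_{q^h}^2$. The weight of a point $\langle v\rangle_{\mathbb{F}_{q^h}}$ in it is $\dim_{\mathbb{F}_q}(W\cap\langle v\rangle_{\mathbb{F}_{q^h}})$. An $i$-club of rank $k$ is an $\mathbb{F}_q$-linear set of rank $k$ in which one point (the head) has weight $i$ and all other points have weight $1$. The relative trace is $L(x)=\sum_{j=0}^{h/(h-i)-1}x^{q^{(h-i)j}}$. -}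

module Defs where

open import Level using (Level; _⊔_)
open import Data.Nat using (ℕ; zero; suc)
import Data.Nat as N
open import Data.Sum using (_⊎_)
open import Relation.Binary.PropositionalEquality using (_≡_)
open import Data.Integer using (ℤ; +_; -[1+_])
open import Data.List using (List; length; filter)
open import Data.List.Relation.Unary.Any using (Any)
open import Data.List.Relation.Unary.AllPairs using (AllPairs)
open import Data.List.Relation.Unary.Any using (any?)
open import Data.Product using (Σ; _×_; _,_)
open import Relation.Nullary using (¬_; Dec)
open import Relation.Nullary.Decidable using (_×-dec_)
open import Relation.Binary using (Decidable)
open import Algebra.Bundles using (CommutativeRing)

record FiniteField (c ℓ : Level) : Set (Level.suc (c ⊔ ℓ)) where
  field
    ring      : CommutativeRing c ℓ
  open CommutativeRing ring public hiding (ring)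
  field
    _≟_       : Decidable _≈_
    1≉0       : ¬ (1# ≈ 0#)
    inverse   : ∀ x → ¬ (x ≈ 0#) → Σ Carrier λ y → x * y ≈ 1#
    elems     : List Carrier
    complete  : ∀ x → Any (x ≈_) elems
    distinct  : AllPairs (λ a b → ¬ (a ≈ b)) elems

  size : ℕ
  size = length elems

  pow : Carrier → ℕ → Carrier
  pow x zero    = 1#
  pow x (suc k) = x * pow x k

  NonZero² : Carrier × Carrier → Set ℓ
  NonZero² (a , b) = ¬ (a ≈ 0#) ⊎ ¬ (b ≈ 0#)

  InSpan : Carrier × Carrier → Carrier × Carrier → Set (c ⊔ ℓ)
  InSpan (a , b) (c′ , d) = Σ Carrier λ μ → (a ≈ μ * c′) × (b ≈ μ * d)

  inSpan? : ∀ u v → Dec (Any (λ μ → (Data.Product.proj₁ u ≈ μ * Data.Product.proj₁ v)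
                                   × (Data.Product.proj₂ u ≈ μ * Data.Product.proj₂ v)) elems)
  inSpan? (a , b) (c′ , d) = any? (λ μ → (a ≈? (μ * c′)) ×-dec (b ≈? (μ * d))) elems
    where
    _≈?_ = _≟_

module FieldOps {c ℓ : Level} (F : FiniteField c ℓ) (q : ℕ) where
  open FiniteField F

  frob : ℕ → Carrier → Carrier
  frob k x = pow x (q N.^ k)

  -- x ↦ x^{q^n} for an integer n, on F_{q^h}: for n < 0 this is the inverse of
  -- x ↦ x^{q^{|n|}}, i.e. x ↦ x^{q^{h|n| - |n|}}
  frobℤ : ℕ → ℤ → Carrier → Carrier
  frobℤ h (+ k)      x = frob k x
  frobℤ h (-[1+ k ]) x = frob (h N.* suc k N.∸ suc k) x

  sumTo : ℕ → (ℕ → Carrier) → Carrier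
  sumTo zero    f = 0#
  sumTo (suc m) f = sumTo m f + f m

  -- relative trace from F_{q^h} to F_{q^t}, where h = m * t:
  -- L(x) = Σ_{j=0}^{m-1} x^{q^{t j}}
  relTrace : (t m : ℕ) → Carrier → Carrier
  relTrace t m x = sumTo m (λ j → frob (t N.* j) x)

  InFq : Carrier → Set ℓ
  InFq a = pow a q ≈ a

  -- Given W = { (f x , x) : x ∈ F }, the size of W ∩ ⟨v⟩_F, i.e.
  -- the number of x ∈ F with (f x , x) ∈ ⟨v⟩_F.
  -- (The F_q-dimension of this F_q-subspace is w iff this number is q^w.)
  meetSize : (Carrier → Carrier) → Carrier × Carrier → ℕ
  meetSize f v = length (filter (λ x → inSpan? (f x , x) v) elems)

  HasWeight : (Carrier → Carrier) → Carrier × Carrier → ℕ → Set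
  HasWeight f v w = meetSize f v ≡ q N.^ w

  -- W = {(f x, x)} is an F_q-subspace of F^2 (i.e. f is F_q-linear)
  FqLinear : (Carrier → Carrier) → Set (c ⊔ ℓ)
  FqLinear f = (∀ x y → f (x + y) ≈ f x + f y)
             × (∀ a x → InFq a → f (a * x) ≈ a * f x)

  -- L_W, W = {(f x, x) : x ∈ F}, is an i-club of rank h:
  -- W is an F_q-subspace with q^h elements, and there is a point ⟨v⟩ of L_W of
  -- weight i (the head) while every other point ⟨(f x, x)⟩, x ≠ 0, has weight 1.
  IsClub : (Carrier → Carrier) → (i h : ℕ) → Set (c ⊔ ℓ)
  IsClub f i h =
    FqLinear f
    × size ≡ q N.^ h
    × Σ (Carrier × Carrier) λ v →
        NonZero² v
        × Σ Carrier (λ x₀ → ¬ (x₀ ≈ 0#) × InSpan (f x₀ , x₀) v)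
        × HasWeight f v i
        × (∀ x → ¬ (x ≈ 0#) → ¬ InSpan (f x , x) v → HasWeight f (f x , x) 1)

-- Put t = h - i, so f(x) = L(x)^{q^n} with L(x) = Σ_{j<h/t} x^{q^{tj}}. L is additive and lands in the
-- subfield F_{q^t} fixed by x ↦ x^{q^t}. Counting roots of polynomials, |F_{q^t}| ≤ q^t and
-- |ker L| ≤ q^{h-t}; as q^h = |F| ≤ |F_{q^t}| · |ker L|, both are equalities. So the head ⟨(0,1)⟩ meets
-- W = {(f x, x)} in ker L, of size q^i. For f x ≠ 0 the point ⟨(f x, x)⟩ meets W in the μ x with
-- f(μ x) = μ f(x); such μ lie in F_{q^t} and are fixed by x ↦ x^{q^|n|}, hence lie in F_q since
-- gcd(t, |n|) = 1, and |F_q| = q is the case t = 1 of the count above. The finite-field facts behind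
-- this (characteristic p, x^{|F|} = x, additivity of x ↦ x^p) follow from the enumeration of F:
-- sums and products over it are invariant under translations and nonzero dilations.

module Submission where

open import Defs
open import Level using (Level; _⊔_)
open import Algebra.Bundles using (CommutativeMonoid; CommutativeRing)
open import Data.Fin as Fin using (Fin; fromℕ)
import Data.Fin.Properties as Finₚ
open import Data.Integer using (ℤ; +_; -[1+_]; ∣_∣)
open import Data.List using (List; []; _∷_; _++_; length; map; foldr; filter; concatMap)
open import Data.List.Properties using (length-++; length-map; ++-identityʳ; filter-none)
open import Data.List.Relation.Unary.All as All using (All; []; _∷_)
open import Data.List.Relation.Unary.All.Properties using (all-filter; ¬Any⇒All¬) renaming (map⁺ to All-map⁺)
open import Data.List.Relation.Unary.AllPairs using ([]; _∷_)
open import Data.List.Relation.Unary.Any as Any using (Any; here; there; any?; satisfied)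
import Data.List.Relation.Unary.Any.Properties as Anyₚ
import Data.List.Relation.Unary.Unique.Setoid.Properties as Unique
open import Data.Maybe using (nothing)
open import Data.Nat as ℕ using (ℕ; zero; suc; _≤_; _<_; z≤n; s≤s; NonZero)
open import Data.Nat.Combinatorics using (_C_; nCn≡1; nC1≡n; nCk+nC[k+1]≡[n+1]C[k+1]; k>n⇒nCk≡0)
open import Data.Nat.Divisibility using (_∣_; divides; ∣⇒≤)
open import Data.Nat.GCD using (gcd; gcd-GCD; module Bézout)
open import Data.Nat.Primality using (Prime; euclidsLemma; prime⇒nonTrivial; prime⇒nonZero)
import Data.Nat.Properties as ℕ
open import Data.Nat.Tactic.RingSolver using (solve-∀)
open import Data.Product using (Σ; ∃; _,_)
open import Data.Sum using (_⊎_; inj₁; inj₂)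
open import Data.Vec using (Vec; []; _∷_; replicate)
open import Data.Vec.Functional using (init)
open import Function using (_∘_)
open import Relation.Binary.Bundles using (Setoid)
open import Relation.Binary.Definitions using (_Respects_)
open import Relation.Binary.PropositionalEquality as ≡ using (_≡_)
open import Relation.Nullary using (¬_; yes; no; contradiction)
open import Relation.Unary using (Pred; Decidable)
open import Relation.Unary.Properties using (∁?)

module _ where
  open import Data.Nat using (_+_; _*_)

  [k+1]*[n+1]C[k+1]≡[n+1]*nCk : ∀ n k → suc k * (suc n C suc k) ≡ suc n * (n C k)
  [k+1]*[n+1]C[k+1]≡[n+1]*nCk zero zero = ≡.refl
  [k+1]*[n+1]C[k+1]≡[n+1]*nCk zero (suc k)
    rewrite k>n⇒nCk≡0 {1} {suc (suc k)} (s≤s (s≤s z≤n)) | k>n⇒nCk≡0 {0} {suc k} (s≤s z≤n)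
    = ℕ.*-zeroʳ (suc (suc k))
  [k+1]*[n+1]C[k+1]≡[n+1]*nCk (suc n) zero =
    ≡.trans (ℕ.+-identityʳ _) (≡.trans (nC1≡n (suc (suc n))) (≡.sym (ℕ.*-identityʳ (suc (suc n)))))
  [k+1]*[n+1]C[k+1]≡[n+1]*nCk (suc n) (suc k) = begin
    suc (suc k) * (suc (suc n) C suc (suc k))
      ≡⟨ ≡.cong (suc (suc k) *_) (nCk+nC[k+1]≡[n+1]C[k+1] (suc n) (suc k)) ⟨
    suc (suc k) * (suc n C suc k + suc n C suc (suc k))
      ≡⟨ distribute (suc n C suc k) k (suc n C suc (suc k)) ⟩
    suc n C suc k + suc k * (suc n C suc k) + suc (suc k) * (suc n C suc (suc k))
      ≡⟨ ≡.cong₂ (λ a b → suc n C suc k + a + b)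
           ([k+1]*[n+1]C[k+1]≡[n+1]*nCk n k) ([k+1]*[n+1]C[k+1]≡[n+1]*nCk n (suc k)) ⟩
    suc n C suc k + suc n * (n C k) + suc n * (n C suc k)
      ≡⟨ collect (suc n C suc k) (suc n) (n C k) (n C suc k) ⟩
    suc n C suc k + suc n * (n C k + n C suc k)
      ≡⟨ ≡.cong (λ c → suc n C suc k + suc n * c) (nCk+nC[k+1]≡[n+1]C[k+1] n k) ⟩
    suc n C suc k + suc n * (suc n C suc k)
      ∎
    where
    open ≡.≡-Reasoning
    distribute : ∀ a k b → suc (suc k) * (a + b) ≡ a + suc k * a + suc (suc k) * b
    distribute = solve-∀
    collect : ∀ a m b c → a + m * b + m * c ≡ a + m * (b + c)
    collect = solve-∀

  p∣pCk : ∀ {p k} → Prime p → 0 < k → k < p → p ∣ p C k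
  p∣pCk {suc n} {suc k} p-prime _ k<p
    with euclidsLemma (suc k) (suc n C suc k) p-prime
           (divides (n C k) (≡.trans ([k+1]*[n+1]C[k+1]≡[n+1]*nCk n k) (ℕ.*-comm (suc n) (n C k))))
  ... | inj₁ p∣k = contradiction (∣⇒≤ p∣k) (ℕ.<⇒≱ k<p)
  ... | inj₂ p∣C = p∣C

  m*n≤o*p⇒p≤n⇒m≤o : ∀ {m n o p} .{{_ : NonZero n}} → m * n ≤ o * p → p ≤ n → m ≤ o
  m*n≤o*p⇒p≤n⇒m≤o {m} {n} {o} mn≤op p≤n =
    ℕ.*-cancelʳ-≤ m o n (ℕ.≤-trans mn≤op (ℕ.*-monoʳ-≤ o p≤n))

  length-concatMap≤ : ∀ {a b} {A : Set a} {B : Set b} (f : A → List B) {k} →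
                      (∀ x → length (f x) ≤ k) → ∀ xs → length (concatMap f xs) ≤ length xs * k
  length-concatMap≤ f |f|≤k []       = z≤n
  length-concatMap≤ f |f|≤k (x ∷ xs) = ≡.subst (_≤ _) (≡.sym (length-++ (f x)))
    (ℕ.+-mono-≤ (|f|≤k x) (length-concatMap≤ f |f|≤k xs))

  length-filter+length-filter-∁ : ∀ {a p} {A : Set a} {P : Pred A p} (P? : Decidable P) xs →
                                  length (filter P? xs) + length (filter (∁? P?) xs) ≡ length xs
  length-filter+length-filter-∁ P? []       = ≡.refl
  length-filter+length-filter-∁ P? (x ∷ xs) with P? x
  ... | yes _ = ≡.cong suc (length-filter+length-filter-∁ P? xs)
  ... | no _  = ≡.trans (ℕ.+-suc _ _) (≡.cong suc (length-filter+length-filter-∁ P? xs))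

module UniqueSublist {a ℓ} (S : Setoid a ℓ) where
  open Setoid S
  open import Data.List.Membership.Setoid S using (_∈_)
  open import Data.List.Membership.Setoid.Properties using (∈-∃++; ∈-resp-≋; ∈-++⁻; ∈-++⁺ˡ; ∈-++⁺ʳ)
  open import Data.List.Relation.Binary.Permutation.Setoid S using (_↭_; ↭-refl; ↭-trans; ↭-reflexive-≋; prep)
  open import Data.List.Relation.Binary.Permutation.Setoid.Properties S using (↭-shift; xs↭ys⇒|xs|≡|ys|)
  open import Data.List.Relation.Unary.Unique.Setoid S using (Unique)

  ∈-removeMiddle : ∀ {z w} as bs → z ∈ as ++ w ∷ bs → ¬ z ≈ w → z ∈ as ++ bs
  ∈-removeMiddle as bs z∈ z≉w with ∈-++⁻ S as z∈
  ... | inj₁ z∈as         = ∈-++⁺ˡ S z∈as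
  ... | inj₂ (here z≈w)   = contradiction z≈w z≉w
  ... | inj₂ (there z∈bs) = ∈-++⁺ʳ S as z∈bs

  unique⊆⇒↭++ : ∀ {xs ys} → Unique xs → All (_∈ ys) xs → ∃ λ zs → ys ↭ xs ++ zs
  unique⊆⇒↭++ {[]}     {ys} _ _ = ys , ↭-refl
  unique⊆⇒↭++ {x ∷ xs} (x≉xs ∷ xs!) (x∈ys ∷ xs⊆ys)
    with as , bs , w , x≈w , ys≋ ← ∈-∃++ S x∈ys
    with zs , ih ← unique⊆⇒↭++ xs! (All.zipWith (λ (x≉z , z∈ys) → ∈-removeMiddle as bs (∈-resp-≋ S ys≋ z∈ys)
                                                      (λ z≈w → x≉z (trans x≈w (sym z≈w)))) (x≉xs , xs⊆ys))
    = zs , ↭-trans (↭-reflexive-≋ ys≋) (↭-trans (↭-shift as bs) (prep (sym x≈w) ih))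

  unique⊆⇒length≤ : ∀ {xs ys} → Unique xs → All (_∈ ys) xs → length xs ≤ length ys
  unique⊆⇒length≤ {xs} {ys} xs! xs⊆ys with zs , ys↭ ← unique⊆⇒↭++ xs! xs⊆ys = begin
    length xs                   ≤⟨ ℕ.m≤m+n (length xs) (length zs) ⟩
    length xs ℕ.+ length zs     ≡⟨ length-++ xs ⟨
    length (xs ++ zs)           ≡⟨ xs↭ys⇒|xs|≡|ys| ys↭ ⟨
    length ys                   ∎
    where open ℕ.≤-Reasoning

  unique⊆-length≡⇒↭ : ∀ {xs ys} → Unique xs → All (_∈ ys) xs → length xs ≡ length ys → ys ↭ xs
  unique⊆-length≡⇒↭ {xs} {ys} xs! xs⊆ys |xs|≡|ys| with unique⊆⇒↭++ xs! xs⊆ys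
  ... | [] , ys↭ rewrite ++-identityʳ xs = ys↭
  ... | z ∷ zs , ys↭ = contradiction (begin
    length xs ℕ.+ length (z ∷ zs)  ≡⟨ length-++ xs ⟨
    length (xs ++ z ∷ zs)         ≡⟨ xs↭ys⇒|xs|≡|ys| ys↭ ⟨
    length ys                     ≡⟨ |xs|≡|ys| ⟨
    length xs                     ∎) (ℕ.m+1+n≢m (length xs))
    where open ≡.≡-Reasoning

module CommutativeMonoidFold {a ℓ} (M : CommutativeMonoid a ℓ) where
  open CommutativeMonoid M
  open import Algebra.Definitions.RawMonoid rawMonoid using (_×_)
  open import Algebra.Properties.CommutativeSemigroup commutativeSemigroup using (interchange)
  open import Data.List.Membership.Setoid setoid using (_∈_)
  open import Data.List.Relation.Unary.Unique.Setoid setoid using (Unique)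
  open import Data.List.Relation.Binary.Permutation.Setoid setoid using (_↭_)
  open import Data.List.Relation.Binary.Permutation.Setoid.Properties setoid using (foldr-commMonoid)
  open import Relation.Binary.Reasoning.Setoid setoid
  open UniqueSublist setoid

  foldr-map-∙ʳ : ∀ x xs → foldr _∙_ ε (map (_∙ x) xs) ≈ foldr _∙_ ε xs ∙ (length xs × x)
  foldr-map-∙ʳ x []       = sym (identityˡ ε)
  foldr-map-∙ʳ x (y ∷ ys) = trans (∙-congˡ (foldr-map-∙ʳ x ys)) (interchange y x _ _)

  shift-closed⇒foldr∙|xs|×x≈foldr : ∀ {xs} x → Unique xs → (∀ {y z} → y ∙ x ≈ z ∙ x → y ≈ z) →
                                   All (λ y → y ∙ x ∈ xs) xs →
                                   foldr _∙_ ε xs ∙ (length xs × x) ≈ foldr _∙_ ε xs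
  shift-closed⇒foldr∙|xs|×x≈foldr {xs} x xs! ∙x-injective closed = begin
    foldr _∙_ ε xs ∙ (length xs × x) ≈⟨ foldr-map-∙ʳ x xs ⟨
    foldr _∙_ ε (map (_∙ x) xs)       ≈⟨ foldr-commMonoid isCommutativeMonoid xs↭ ⟨
    foldr _∙_ ε xs                    ∎
    where
    xs↭ : xs ↭ map (_∙ x) xs
    xs↭ = unique⊆-length≡⇒↭ (Unique.map⁺ setoid setoid ∙x-injective xs!) (All-map⁺ closed)
                            (length-map (_∙ x) xs)

module FiniteFieldProperties {c ℓ} (F : FiniteField c ℓ) where
  open FiniteField F
  open import Algebra.Properties.Group +-group
    using (x∙y⁻¹≈ε⇒x≈y; x≈y⇒x∙y⁻¹≈ε; ∙-cancelˡ; ∙-cancelʳ; //-rightDividesˡ)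
  open import Algebra.Properties.Ring (CommutativeRing.ring ring) using ([y-z]x≈yx-zx; x+x≈x⇒x≈0)
  open import Algebra.Properties.Semiring.Exp semiring using (_^_; ^-assocʳ)
  open import Algebra.Properties.CommutativeSemiring.Exp commutativeSemiring using (^-distrib-*)
  import Algebra.Properties.Semiring.Mult semiring as Mult
  open import Data.Product using (_×_)
  open import Data.List.Membership.Setoid setoid using (_∈_)
  open import Data.List.Membership.Setoid.Properties using (∈-filter⁺)
  import Data.List.Relation.Unary.Unique.Setoid.Properties as Unique
  open import Relation.Binary.Reasoning.Setoid setoid
  open import Data.List.Relation.Unary.Unique.Setoid setoid using (Unique)
  open import Algebra.Solver.Ring.NaturalCoefficients commutativeSemiring (λ _ _ → nothing)
  open UniqueSublist setoid

  x*y≈0⇒x≈0⊎y≈0 : ∀ {x y} → x * y ≈ 0# → x ≈ 0# ⊎ y ≈ 0#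
  x*y≈0⇒x≈0⊎y≈0 {x} {y} xy≈0 with x ≟ 0#
  ... | yes x≈0 = inj₁ x≈0
  ... | no x≉0 with x⁻¹ , xx⁻¹≈1 ← inverse x x≉0 = inj₂ (begin
    y               ≈⟨ *-identityˡ y ⟨
    1# * y          ≈⟨ *-congʳ (trans (sym xx⁻¹≈1) (*-comm x x⁻¹)) ⟩
    (x⁻¹ * x) * y   ≈⟨ *-assoc x⁻¹ x y ⟩
    x⁻¹ * (x * y)   ≈⟨ *-congˡ xy≈0 ⟩
    x⁻¹ * 0#        ≈⟨ zeroʳ x⁻¹ ⟩
    0#              ∎)

  *-≉0 : ∀ {x y} → x ≉ 0# → y ≉ 0# → x * y ≉ 0#
  *-≉0 x≉0 y≉0 xy≈0 with x*y≈0⇒x≈0⊎y≈0 xy≈0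
  ... | inj₁ x≈0 = x≉0 x≈0
  ... | inj₂ y≈0 = y≉0 y≈0

  *-cancelʳ-≉0 : ∀ {x y z} → z ≉ 0# → x * z ≈ y * z → x ≈ y
  *-cancelʳ-≉0 {x} {y} {z} z≉0 xz≈yz
    with x*y≈0⇒x≈0⊎y≈0 (trans ([y-z]x≈yx-zx z x y) (x≈y⇒x∙y⁻¹≈ε xz≈yz))
  ... | inj₁ x-y≈0 = x∙y⁻¹≈ε⇒x≈y x y x-y≈0
  ... | inj₂ z≈0   = contradiction z≈0 z≉0

  x*y≈1⇒y≉0 : ∀ {x y} → x * y ≈ 1# → y ≉ 0#
  x*y≈1⇒y≉0 {x} xy≈1 y≈0 = 1≉0 (trans (sym xy≈1) (trans (*-congˡ y≈0) (zeroʳ x)))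

  pow≡^ : ∀ x n → pow x n ≡ x ^ n
  pow≡^ x zero    = ≡.refl
  pow≡^ x (suc n) = ≡.cong (x *_) (pow≡^ x n)

  pow-≉0 : ∀ {x} n → x ≉ 0# → pow x n ≉ 0#
  pow-≉0 zero    x≉0 = 1≉0
  pow-≉0 (suc n) x≉0 = *-≉0 x≉0 (pow-≉0 n x≉0)

  pow≈0⇒≈0 : ∀ {x} n → pow x n ≈ 0# → x ≈ 0#
  pow≈0⇒≈0 {x} n xⁿ≈0 with x ≟ 0#
  ... | yes x≈0 = x≈0
  ... | no x≉0  = contradiction xⁿ≈0 (pow-≉0 n x≉0)

  pow-cong : ∀ {x y} n → x ≈ y → pow x n ≈ pow y n
  pow-cong zero    x≈y = refl
  pow-cong (suc n) x≈y = *-cong x≈y (pow-cong n x≈y)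

  pow-* : ∀ x m n → pow x (m ℕ.* n) ≈ pow (pow x m) n
  pow-* x m n rewrite pow≡^ x (m ℕ.* n) | pow≡^ (pow x m) n | pow≡^ x m = sym (^-assocʳ x m n)

  pow-distrib-* : ∀ x y n → pow (x * y) n ≈ pow x n * pow y n
  pow-distrib-* x y n rewrite pow≡^ (x * y) n | pow≡^ x n | pow≡^ y n = ^-distrib-* x y n

  pow-1# : ∀ n → pow 1# n ≈ 1#
  pow-1# zero    = refl
  pow-1# (suc n) = trans (*-identityˡ _) (pow-1# n)

  count : ∀ {p} {P : Pred Carrier p} → Decidable P → ℕ
  count P? = length (filter P? elems)

  count-≤ : ∀ {p q} {P : Pred Carrier p} {Q : Pred Carrier q} (P? : Decidable P) (Q? : Decidable Q) →
            Q Respects _≈_ → (g : Carrier → Carrier) → (∀ {x y} → g x ≈ g y → x ≈ y) →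
            (∀ {x} → P x → Q (g x)) → count P? ≤ count Q?
  count-≤ P? Q? Q-resp g g-injective P⇒Q∘g =
    ≡.subst (_≤ count Q?) (length-map g (filter P? elems))
      (unique⊆⇒length≤ (Unique.map⁺ setoid setoid g-injective (Unique.filter⁺ setoid P? distinct))
        (All-map⁺ (All.map (λ {x} Px → ∈-filter⁺ setoid Q? Q-resp (complete (g x)) (P⇒Q∘g Px))
          (all-filter P? elems))))

  count-≡ : ∀ {p q} {P : Pred Carrier p} {Q : Pred Carrier q} (P? : Decidable P) (Q? : Decidable Q) →
            P Respects _≈_ → Q Respects _≈_ → (∀ {x} → P x → Q x) → (∀ {x} → Q x → P x) →
            count P? ≡ count Q?
  count-≡ P? Q? P-resp Q-resp P⇒Q Q⇒P =
    ℕ.≤-antisym (count-≤ P? Q? Q-resp (λ x → x) (λ x≈y → x≈y) P⇒Q)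
                (count-≤ Q? P? P-resp (λ x → x) (λ x≈y → x≈y) Q⇒P)

  module AdditiveMap (g : Carrier → Carrier) (g-cong : ∀ {x y} → x ≈ y → g x ≈ g y)
                     (g-+ : ∀ x y → g (x + y) ≈ g x + g y) where

    g-0# : g 0# ≈ 0#
    g-0# = x+x≈x⇒x≈0 (g 0#) (trans (sym (g-+ 0# 0#)) (g-cong (+-identityʳ 0#)))

    g-‿ : ∀ x y → g (x - y) ≈ g x - g y
    g-‿ x y = ∙-cancelʳ (g y) _ _ (begin
      g (x - y) + g y   ≈⟨ g-+ (x - y) y ⟨
      g (x - y + y)     ≈⟨ g-cong (//-rightDividesˡ y x) ⟩
      g x               ≈⟨ //-rightDividesˡ (g y) (g x) ⟨
      g x - g y + g y   ∎)

    kernel-trivial⇒injective : (∀ {x} → g x ≈ 0# → x ≈ 0#) → ∀ {x y} → g x ≈ g y → x ≈ y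
    kernel-trivial⇒injective ker≈0 {x} {y} gx≈gy =
      x∙y⁻¹≈ε⇒x≈y x y (ker≈0 (trans (g-‿ x y) (x≈y⇒x∙y⁻¹≈ε gx≈gy)))

    fiber? : ∀ r → Decidable (λ x → g x ≈ r)
    fiber? r x = g x ≟ r

    fiber-resp : ∀ r → (λ x → g x ≈ r) Respects _≈_
    fiber-resp r x≈y gx≈r = trans (g-cong (sym x≈y)) gx≈r

    -- A nonempty fibre is a translate x₀ + ker g of the kernel.
    count-fiber≤count-kernel : ∀ r → count (fiber? r) ≤ count (fiber? 0#)
    count-fiber≤count-kernel r with any? (fiber? r) elems
    ... | no ∄x =
      ℕ.≤-trans (ℕ.≤-reflexive (≡.cong length (filter-none (fiber? r) (¬Any⇒All¬ elems ∄x)))) z≤n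
    ... | yes ∃x with x₀ , gx₀≈r ← satisfied ∃x =
      count-≤ (fiber? r) (fiber? 0#) (fiber-resp 0#) (_- x₀) (∙-cancelʳ (- x₀) _ _)
        (λ {x} gx≈r → trans (g-‿ x x₀) (x≈y⇒x∙y⁻¹≈ε (trans gx≈r (sym gx₀≈r))))

    size≤count*count-kernel : ∀ {t} {T : Pred Carrier t} (T? : Decidable T) → T Respects _≈_ →
                              (∀ x → T (g x)) → size ≤ count T? ℕ.* count (fiber? 0#)
    size≤count*count-kernel T? T-resp g∈T = ℕ.≤-trans
      (unique⊆⇒length≤ distinct (All.universal covered elems))
      (length-concatMap≤ (λ r → filter (fiber? r) elems) count-fiber≤count-kernel (filter T? elems))
      where
      covered : ∀ x → x ∈ concatMap (λ r → filter (fiber? r) elems) (filter T? elems)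
      covered x = Anyₚ.concatMap⁺ (λ r → filter (fiber? r) elems)
        (Any.map (λ {r} gx≈r → ∈-filter⁺ setoid (fiber? r) (fiber-resp r) (complete x) gx≈r)
                 (∈-filter⁺ setoid T? T-resp (complete (g x)) (g∈T x)))

  -- a₀ ∷ a₁ ∷ ⋯ ∷ a_{d-1} ∷ [] stands for the monic polynomial a₀ + a₁ x + ⋯ + a_{d-1} x^{d-1} + x^d.
  Monic : ℕ → Set c
  Monic = Vec Carrier

  eval : ∀ {d} → Monic d → Carrier → Carrier
  eval []       x = 1#
  eval (a ∷ as) x = a + x * eval as x

  quotient : ∀ {d} → Monic (suc d) → Carrier → Monic d
  quotient (a ∷ [])          r = []
  quotient (a ∷ as@(_ ∷ _)) r = eval as r ∷ quotient as r

  eval-quotient : ∀ {d} (P : Monic (suc d)) x r → eval P x ≈ (x - r) * eval (quotient P r) x + eval P r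
  eval-quotient (a ∷ []) x r = begin
    a + x * 1#                     ≈⟨ +-congˡ (*-congʳ (//-rightDividesˡ r x)) ⟨
    a + (x - r + r) * 1#
      ≈⟨ solve 3 (λ a δ r → a :+ (δ :+ r) :* con 1 := δ :* con 1 :+ (a :+ r :* con 1)) refl a (x - r) r ⟩
    (x - r) * 1# + (a + r * 1#)    ∎
  eval-quotient (a ∷ as@(_ ∷ _)) x r = begin
    a + x * eval as x                      ≈⟨ +-congˡ (*-cong (sym (//-rightDividesˡ r x)) (eval-quotient as x r)) ⟩
    a + (δ + r) * (δ * Q + R)
      ≈⟨ solve 5 (λ a δ r Q R → a :+ (δ :+ r) :* (δ :* Q :+ R) := δ :* (R :+ (δ :+ r) :* Q) :+ (a :+ r :* R))
                 refl a δ r Q R ⟩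
    δ * (R + (δ + r) * Q) + (a + r * R)    ≈⟨ +-congʳ (*-congˡ (+-congˡ (*-congʳ (//-rightDividesˡ r x)))) ⟩
    δ * (R + x * Q) + (a + r * R)          ∎
    where
    δ Q R : Carrier
    δ = x - r
    Q = eval (quotient as r) x
    R = eval as r

  roots≤degree : ∀ {d} (P : Monic d) {rs} → Unique rs → All (λ r → eval P r ≈ 0#) rs → length rs ≤ d
  roots≤degree []      {[]}     _           _               = z≤n
  roots≤degree []      {r ∷ rs} _           (1≈0 ∷ _)       = contradiction 1≈0 1≉0
  roots≤degree (_ ∷ _) {[]}     _           _               = z≤n
  roots≤degree P@(_ ∷ _) {r ∷ rs} (r≉rs ∷ rs!) (Pr≈0 ∷ Prs≈0) =
    s≤s (roots≤degree (quotient P r) rs!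
          (All.zipWith (λ (r≉s , Ps≈0) → root-of-quotient r≉s Ps≈0) (r≉rs , Prs≈0)))
    where
    root-of-quotient : ∀ {s} → r ≉ s → eval P s ≈ 0# → eval (quotient P r) s ≈ 0#
    root-of-quotient {s} r≉s Ps≈0 with x*y≈0⇒x≈0⊎y≈0 (begin
      (s - r) * eval (quotient P r) s              ≈⟨ +-identityʳ _ ⟨
      (s - r) * eval (quotient P r) s + 0#         ≈⟨ +-congˡ Pr≈0 ⟨
      (s - r) * eval (quotient P r) s + eval P r   ≈⟨ eval-quotient P s r ⟨
      eval P s                                     ≈⟨ Ps≈0 ⟩
      0#                                           ∎)
    ... | inj₁ s-r≈0 = contradiction (sym (x∙y⁻¹≈ε⇒x≈y s r s-r≈0)) r≉s
    ... | inj₂ Qs≈0  = Qs≈0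

  count-roots≤degree : ∀ {d} (P : Monic d) {z} {Z : Pred Carrier z} (Z? : Decidable Z) →
                       (∀ {x} → Z x → eval P x ≈ 0#) → count Z? ≤ d
  count-roots≤degree P Z? Z⇒root =
    roots≤degree P (Unique.filter⁺ setoid Z? distinct) (All.map Z⇒root (all-filter Z? elems))

  xᵈ : ∀ d → Monic d
  xᵈ d = replicate d 0#

  eval-xᵈ : ∀ d x → eval (xᵈ d) x ≈ pow x d
  eval-xᵈ zero    x = refl
  eval-xᵈ (suc d) x = trans (+-identityˡ _) (*-congˡ (eval-xᵈ d x))

  addTerm : ∀ {d} → Carrier → (k : ℕ) → k ℕ.< d → Monic d → Monic d
  addTerm b zero    _         (a ∷ as) = a + b ∷ as
  addTerm b (suc k) (s≤s k<d) (a ∷ as) = a ∷ addTerm b k k<d as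

  eval-addTerm : ∀ {d} b k (k<d : k ℕ.< d) (P : Monic d) x → eval (addTerm b k k<d P) x ≈ eval P x + b * pow x k
  eval-addTerm b zero    _         (a ∷ as) x =
    solve 4 (λ a b x E → (a :+ b) :+ x :* E := (a :+ x :* E) :+ b :* con 1) refl a b x (eval as x)
  eval-addTerm b (suc k) (s≤s k<d) (a ∷ as) x = begin
    a + x * eval (addTerm b k k<d as) x   ≈⟨ +-congˡ (*-congˡ (eval-addTerm b k k<d as x)) ⟩
    a + x * (eval as x + b * pow x k)
      ≈⟨ solve 5 (λ a b x E K → a :+ x :* (E :+ b :* K) := (a :+ x :* E) :+ b :* (x :* K))
                 refl a b x (eval as x) (pow x k) ⟩
    (a + x * eval as x) + b * (x * pow x k) ∎

  -- x ↦ x + 1# permutes F, so adding 1# to every element does not change their sum.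
  size×1#≈0# : size Mult.× 1# ≈ 0#
  size×1#≈0# = ∙-cancelˡ (foldr _+_ 0# elems) _ _ (begin
    foldr _+_ 0# elems + size Mult.× 1#  ≈⟨ shift-closed⇒foldr∙|xs|×x≈foldr 1# distinct (∙-cancelʳ 1# _ _)
                                         (All.universal (λ x → complete (x + 1#)) elems) ⟩
    foldr _+_ 0# elems              ≈⟨ +-identityʳ _ ⟨
    foldr _+_ 0# elems + 0#         ∎)
    where open CommutativeMonoidFold +-commutativeMonoid

  Unique⇒2≤length⇒∃≉0 : ∀ {p} {P : Pred Carrier p} {xs} → Unique xs → 2 ≤ length xs → All P xs →
                        ∃ λ x → x ≉ 0# × P x
  Unique⇒2≤length⇒∃≉0 {xs = _ ∷ []} _ (s≤s ()) _
  Unique⇒2≤length⇒∃≉0 {xs = a ∷ b ∷ _} ((a≉b ∷ _) ∷ _) _ (Pa ∷ Pb ∷ _) with a ≟ 0#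
  ... | yes a≈0 = b , (λ b≈0 → a≉b (trans a≈0 (sym b≈0))) , Pb
  ... | no a≉0  = a , a≉0 , Pa

  nonzero? : Decidable (_≉ 0#)
  nonzero? = ∁? (_≟ 0#)

  nonzeros : List Carrier
  nonzeros = filter nonzero? elems

  foldr-*-≉0 : ∀ {xs} → All (_≉ 0#) xs → foldr _*_ 1# xs ≉ 0#
  foldr-*-≉0 []             = 1≉0
  foldr-*-≉0 (x≉0 ∷ xs≉0) = *-≉0 x≉0 (foldr-*-≉0 xs≉0)

  -- x ↦ x * a permutes the nonzero elements, so multiplying each of them by a does not change their product.
  pow-|nonzeros| : ∀ {a} → a ≉ 0# → pow a (length nonzeros) ≈ 1#
  pow-|nonzeros| {a} a≉0 rewrite pow≡^ a (length nonzeros) = *-cancelʳ-≉0 (foldr-*-≉0 nonzeros≉0) (begin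
    a ^ length nonzeros * Π          ≈⟨ *-comm _ Π ⟩
    Π * a ^ length nonzeros          ≈⟨ shift-closed⇒foldr∙|xs|×x≈foldr a (Unique.filter⁺ setoid nonzero? distinct)
                                          (*-cancelʳ-≉0 a≉0) (All.map (λ {x} x≉0 → ∈-filter⁺ setoid nonzero? ≉-resp
                                            (complete (x * a)) (*-≉0 x≉0 a≉0)) nonzeros≉0) ⟩
    Π                                ≈⟨ *-identityˡ Π ⟨
    1# * Π                           ∎)
    where
    open CommutativeMonoidFold *-commutativeMonoid
    Π : Carrier
    Π = foldr _*_ 1# nonzeros
    nonzeros≉0 : All (_≉ 0#) nonzeros
    nonzeros≉0 = all-filter nonzero? elems
    ≉-resp : (_≉ 0#) Respects _≈_
    ≉-resp x≈y x≉0 y≈0 = x≉0 (trans x≈y y≈0)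

  size≡1+|nonzeros| : size ≡ suc (length nonzeros)
  size≡1+|nonzeros| = ≡.trans (≡.sym (length-filter+length-filter-∁ (_≟ 0#) elems))
                              (≡.cong (ℕ._+ length nonzeros) |zeros|≡1)
    where
    zeros : List Carrier
    zeros = filter (_≟ 0#) elems
    0∈zeros : 0# ∈ zeros
    0∈zeros = ∈-filter⁺ setoid (_≟ 0#) (λ x≈y x≈0 → trans (sym x≈y) x≈0) (complete 0#) refl
    |zeros|≡1 : length zeros ≡ 1
    |zeros|≡1 with zeros | 0∈zeros | unique⊆⇒length≤ {ys = 0# ∷ []} (Unique.filter⁺ setoid (_≟ 0#) distinct)
                                       (All.map here (all-filter (_≟ 0#) elems))
    ... | _ ∷ [] | _ | _ = ≡.refl
    ... | _ ∷ _ ∷ _ | _ | s≤s ()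

  pow-size : ∀ a → pow a size ≈ a
  pow-size a rewrite size≡1+|nonzeros| with a ≟ 0#
  ... | yes a≈0 = trans (*-congʳ a≈0) (trans (zeroˡ _) (sym a≈0))
  ... | no a≉0  = trans (*-congˡ (pow-|nonzeros| a≉0)) (*-identityʳ a)

module PrimeCharacteristic {c ℓ} (F : FiniteField c ℓ) where
  open FiniteField F
  open FiniteFieldProperties F
  open import Algebra.Properties.Semiring.Mult semiring using (_×_; ×-assocˡ; ×-congʳ; ×-assoc-*; ×-homo-1; ×1-homo-*)
  open import Algebra.Properties.Semiring.Exp semiring using (_^_)
  open import Algebra.Properties.CommutativeSemiring.Binomial commutativeSemiring using (theorem; binomialTerm)
  open import Algebra.Properties.Monoid.Sum +-monoid using (sum; sum-init-last; sum-cong-≋; sum-replicate-zero)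
  open import Relation.Binary.Reasoning.Setoid setoid

  p×≈0# : ∀ {p} → p × 1# ≈ 0# → ∀ x → p × x ≈ 0#
  p×≈0# {p} p×1#≈0# x = begin
    p × x         ≈⟨ ×-congʳ p (*-identityˡ x) ⟨
    p × (1# * x)  ≈⟨ ×-assoc-* p 1# x ⟨
    p × 1# * x    ≈⟨ *-congʳ p×1#≈0# ⟩
    0# * x        ≈⟨ zeroˡ x ⟩
    0#            ∎

  pCk×≈0# : ∀ {p k} → Prime p → p × 1# ≈ 0# → ∀ x → 0 < k → k < p → (p C k) × x ≈ 0#
  pCk×≈0# {p} {k} p-prime p×1#≈0# x 0<k k<p with divides d pCk≡d*p ← p∣pCk p-prime 0<k k<p = begin
    (p C k) × x     ≡⟨ ≡.cong (_× x) (≡.trans pCk≡d*p (ℕ.*-comm d p)) ⟩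
    (p ℕ.* d) × x   ≈⟨ ×-assocˡ x p d ⟨
    p × (d × x)     ≈⟨ p×≈0# {p} p×1#≈0# (d × x) ⟩
    0#              ∎

  pow-prime-+ : ∀ {p} → Prime p → p × 1# ≈ 0# → ∀ x y → pow (x + y) p ≈ pow x p + pow y p
  pow-prime-+ {zero}  ()
  pow-prime-+ {suc r} p-prime p×1#≈0# x y = begin
    pow (x + y) p                                   ≡⟨ pow≡^ (x + y) p ⟩
    (x + y) ^ p                                     ≈⟨ theorem p x y ⟩
    T Fin.zero + sum (λ k → T (Fin.suc k))          ≈⟨ +-congˡ (sum-init-last (λ k → T (Fin.suc k))) ⟩
    T Fin.zero + (sum inner + T (Fin.suc (fromℕ r))) ≈⟨ +-congˡ (+-congʳ (trans (sum-cong-≋ inner≈0#)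
                                                                                (sum-replicate-zero r))) ⟩
    T Fin.zero + (0# + T (Fin.suc (fromℕ r)))        ≈⟨ +-congˡ (+-identityˡ _) ⟩
    T Fin.zero + T (Fin.suc (fromℕ r))               ≈⟨ +-comm _ _ ⟩
    T (Fin.suc (fromℕ r)) + T Fin.zero               ≈⟨ +-cong last-term first-term ⟩
    x ^ p + y ^ p                                   ≡⟨ ≡.sym (≡.cong₂ _+_ (pow≡^ x p) (pow≡^ y p)) ⟩
    pow x p + pow y p                               ∎
    where
    p : ℕ
    p = suc r
    T : Fin (suc p) → Carrier
    T = binomialTerm x y p
    inner : Fin r → Carrier
    inner = init (λ k → T (Fin.suc k))
    inner≈0# : ∀ k → inner k ≈ 0#
    inner≈0# k = pCk×≈0# p-prime p×1#≈0# _ (s≤s z≤n)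
      (s≤s (≡.subst (ℕ._< r) (≡.sym (Finₚ.toℕ-inject₁ k)) (Finₚ.toℕ<n k)))
    first-term : T Fin.zero ≈ y ^ p
    first-term = trans (×-homo-1 _) (*-identityˡ _)
    last-term : T (Fin.suc (fromℕ r)) ≈ x ^ p
    last-term rewrite Finₚ.toℕ-fromℕ r | nCn≡1 p | ℕ.n∸n≡0 p = trans (×-homo-1 _) (*-identityʳ _)

  ^×1#≈pow : ∀ n k → (n ℕ.^ k) × 1# ≈ pow (n × 1#) k
  ^×1#≈pow n zero    = ×-homo-1 1#
  ^×1#≈pow n (suc k) = trans (×1-homo-* n (n ℕ.^ k)) (*-congˡ (^×1#≈pow n k))

module Frobenius {c ℓ} (F : FiniteField c ℓ) {p e q h : ℕ} (p-prime : Prime p) (1≤e : 1 ≤ e)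
                 (q≡pᵉ : q ≡ p ℕ.^ e) (size≡qʰ : FiniteField.size F ≡ q ℕ.^ h) where
  open FiniteField F
  open FiniteFieldProperties F
  open PrimeCharacteristic F
  open FieldOps F q
  import Algebra.Properties.Semiring.Mult semiring as Mult
  open import Algebra.Properties.Ring (CommutativeRing.ring ring) using (-1*x≈-x)
  open import Algebra.Properties.Group +-group using (∙-cancelʳ)
  open import Algebra.Properties.CommutativeSemigroup +-commutativeSemigroup using (interchange; xy∙z≈xz∙y)
  open import Relation.Binary.Reasoning.Setoid setoid

  qᵏ≡pᵉᵏ : ∀ k → q ℕ.^ k ≡ p ℕ.^ (e ℕ.* k)
  qᵏ≡pᵉᵏ k = ≡.trans (≡.cong (ℕ._^ k) q≡pᵉ) (ℕ.^-*-assoc p e k)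

  1<q : 1 < q
  1<q = ℕ.<-≤-trans (ℕ.nonTrivial⇒n>1 p {{prime⇒nonTrivial p-prime}}) (≡.subst (p ≤_) (≡.sym q≡pᵉ)
    (≡.subst (_≤ p ℕ.^ e) (ℕ.^-identityʳ p) (ℕ.^-monoʳ-≤ p {{prime⇒nonZero p-prime}} 1≤e)))

  q-nonZero : NonZero q
  q-nonZero = ℕ.>-nonZero (ℕ.<-trans ℕ.z<s 1<q)

  qᵏ-nonZero : ∀ k → NonZero (q ℕ.^ k)
  qᵏ-nonZero k = ℕ.m^n≢0 q k {{q-nonZero}}

  1<qᵏ : ∀ {k} → 1 ≤ k → 1 < q ℕ.^ k
  1<qᵏ {k} 1≤k = ℕ.<-≤-trans 1<q
    (≡.subst (_≤ q ℕ.^ k) (ℕ.^-identityʳ q) (ℕ.^-monoʳ-≤ q {{q-nonZero}} 1≤k))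

  p×1#≈0# : p Mult.× 1# ≈ 0#
  p×1#≈0# = pow≈0⇒≈0 (e ℕ.* h) (begin
    pow (p Mult.× 1#) (e ℕ.* h)  ≈⟨ ^×1#≈pow p (e ℕ.* h) ⟨
    (p ℕ.^ (e ℕ.* h)) Mult.× 1#  ≡⟨ ≡.cong (Mult._× 1#) (≡.trans (≡.sym (qᵏ≡pᵉᵏ h)) (≡.sym size≡qʰ)) ⟩
    size Mult.× 1#               ≈⟨ size×1#≈0# ⟩
    0#                      ∎)

  pow-pᵏ-+ : ∀ k x y → pow (x + y) (p ℕ.^ k) ≈ pow x (p ℕ.^ k) + pow y (p ℕ.^ k)
  pow-pᵏ-+ zero    x y = trans (*-identityʳ _) (sym (+-cong (*-identityʳ x) (*-identityʳ y)))
  pow-pᵏ-+ (suc k) x y = begin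
    pow (x + y) (p ℕ.* p ℕ.^ k)                        ≈⟨ pow-* (x + y) p (p ℕ.^ k) ⟩
    pow (pow (x + y) p) (p ℕ.^ k)                      ≈⟨ pow-cong (p ℕ.^ k) (pow-prime-+ p-prime p×1#≈0# x y) ⟩
    pow (pow x p + pow y p) (p ℕ.^ k)                  ≈⟨ pow-pᵏ-+ k (pow x p) (pow y p) ⟩
    pow (pow x p) (p ℕ.^ k) + pow (pow y p) (p ℕ.^ k)  ≈⟨ +-cong (pow-* x p (p ℕ.^ k)) (pow-* y p (p ℕ.^ k)) ⟨
    pow x (p ℕ.* p ℕ.^ k) + pow y (p ℕ.* p ℕ.^ k)      ∎

  frob-cong : ∀ k {x y} → x ≈ y → frob k x ≈ frob k y
  frob-cong k = pow-cong (q ℕ.^ k)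

  frob-+ : ∀ k x y → frob k (x + y) ≈ frob k x + frob k y
  frob-+ k x y rewrite qᵏ≡pᵉᵏ k = pow-pᵏ-+ (e ℕ.* k) x y

  frob-* : ∀ k x y → frob k (x * y) ≈ frob k x * frob k y
  frob-* k x y = pow-distrib-* x y (q ℕ.^ k)

  frob-1# : ∀ k → frob k 1# ≈ 1#
  frob-1# k = pow-1# (q ℕ.^ k)

  module FrobAdditive k = AdditiveMap (frob k) (frob-cong k) (frob-+ k)

  frob-0# : ∀ k → frob k 0# ≈ 0#
  frob-0# k = FrobAdditive.g-0# k

  frob≈0#⇒≈0# : ∀ k {x} → frob k x ≈ 0# → x ≈ 0#
  frob≈0#⇒≈0# k = pow≈0⇒≈0 (q ℕ.^ k)

  frob-injective : ∀ k {x y} → frob k x ≈ frob k y → x ≈ y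
  frob-injective k = FrobAdditive.kernel-trivial⇒injective k (frob≈0#⇒≈0# k)

  frob-frob : ∀ a b x → frob a (frob b x) ≈ frob (a ℕ.+ b) x
  frob-frob a b x = begin
    pow (pow x (q ℕ.^ b)) (q ℕ.^ a)  ≈⟨ pow-* x (q ℕ.^ b) (q ℕ.^ a) ⟨
    pow x (q ℕ.^ b ℕ.* q ℕ.^ a)      ≡⟨ ≡.cong (pow x) (≡.trans (ℕ.*-comm (q ℕ.^ b) (q ℕ.^ a))
                                                                (≡.sym (ℕ.^-distribˡ-+-* q a b))) ⟩
    pow x (q ℕ.^ (a ℕ.+ b))          ∎

  frob-0 : ∀ x → frob 0 x ≈ x
  frob-0 = *-identityʳ

  frob-h : ∀ x → frob h x ≈ x
  frob-h x rewrite ≡.sym size≡qʰ = pow-size x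

  Fixed : ℕ → Carrier → Set ℓ
  Fixed k x = frob k x ≈ x

  Fixed? : ∀ k → Decidable (Fixed k)
  Fixed? k x = frob k x ≟ x

  Fixed-resp : ∀ k → Fixed k Respects _≈_
  Fixed-resp k x≈y fx≈x = trans (frob-cong k (sym x≈y)) (trans fx≈x x≈y)

  InFq⇒Fixed-1 : ∀ {x} → InFq x → Fixed 1 x
  InFq⇒Fixed-1 {x} = ≡.subst (λ k → pow x k ≈ x) (≡.sym (ℕ.*-identityʳ q))

  Fixed-1⇒InFq : ∀ {x} → Fixed 1 x → InFq x
  Fixed-1⇒InFq {x} = ≡.subst (λ k → pow x k ≈ x) (ℕ.*-identityʳ q)

  Fixed-exp-+ : ∀ {a b x} → Fixed a x → Fixed b x → Fixed (a ℕ.+ b) x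
  Fixed-exp-+ {a} {b} {x} fa fb = trans (sym (frob-frob a b x)) (trans (frob-cong a fb) fa)

  Fixed-exp-* : ∀ {a x} j → Fixed a x → Fixed (j ℕ.* a) x
  Fixed-exp-* zero    fa = frob-0 _
  Fixed-exp-* {a} (suc j) fa = Fixed-exp-+ {a} {j ℕ.* a} fa (Fixed-exp-* j fa)

  Fixed-exp-∸ : ∀ {a b x} → Fixed a x → Fixed b x → b ≤ a → Fixed (a ℕ.∸ b) x
  Fixed-exp-∸ {a} {b} {x} fa fb b≤a = frob-injective b (begin
    frob b (frob (a ℕ.∸ b) x)  ≈⟨ frob-frob b (a ℕ.∸ b) x ⟩
    frob (b ℕ.+ (a ℕ.∸ b)) x   ≡⟨ ≡.cong (λ k → frob k x) (ℕ.m+[n∸m]≡n b≤a) ⟩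
    frob a x                   ≈⟨ fa ⟩
    x                          ≈⟨ fb ⟨
    frob b x                   ∎)

  Fixed-1⇒Fixed : ∀ {a} k → Fixed 1 a → Fixed k a
  Fixed-1⇒Fixed {a} k f1 = ≡.subst (λ j → Fixed j a) (ℕ.*-identityʳ k) (Fixed-exp-* k f1)

  Fixed-exp-Bézout : ∀ {a b d x} i j → Fixed a x → Fixed b x → d ℕ.+ j ℕ.* b ≡ i ℕ.* a → Fixed d x
  Fixed-exp-Bézout {a} {b} {d} {x} i j fa fb d+jb≡ia = ≡.subst (λ k → Fixed k x) ia∸jb≡d
    (Fixed-exp-∸ {i ℕ.* a} {j ℕ.* b} (Fixed-exp-* i fa) (Fixed-exp-* j fb)
                 (≡.subst (j ℕ.* b ≤_) d+jb≡ia (ℕ.m≤n+m _ d)))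
    where
    ia∸jb≡d : i ℕ.* a ℕ.∸ j ℕ.* b ≡ d
    ia∸jb≡d = ≡.trans (≡.cong (ℕ._∸ j ℕ.* b) (≡.sym d+jb≡ia)) (ℕ.m+n∸n≡m d (j ℕ.* b))

  Fixed-exp-gcd : ∀ {a b x} → Fixed a x → Fixed b x → Fixed (gcd a b) x
  Fixed-exp-gcd {a} {b} fa fb with Bézout.identity (gcd-GCD a b)
  ... | Bézout.+- i j d+jb≡ia = Fixed-exp-Bézout i j fa fb d+jb≡ia
  ... | Bézout.-+ i j d+ia≡jb = Fixed-exp-Bézout j i fb fa d+ia≡jb

  Fixed-frob : ∀ {k x} j → Fixed k x → Fixed k (frob j x)
  Fixed-frob {k} {x} j fk = begin
    frob k (frob j x)   ≈⟨ frob-frob k j x ⟩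
    frob (k ℕ.+ j) x    ≡⟨ ≡.cong (λ i → frob i x) (ℕ.+-comm k j) ⟩
    frob (j ℕ.+ k) x    ≈⟨ frob-frob j k x ⟨
    frob j (frob k x)   ≈⟨ frob-cong j fk ⟩
    frob j x            ∎

  Fixed-* : ∀ {k x y} → Fixed k x → Fixed k y → Fixed k (x * y)
  Fixed-* {k} fx fy = trans (frob-* k _ _) (*-cong fx fy)

  Fixed-inverse : ∀ {k x y} → x * y ≈ 1# → Fixed k x → Fixed k y
  Fixed-inverse {k} {x} {y} xy≈1 fx = *-cancelʳ-≉0 (x*y≈1⇒y≉0 (trans (*-comm y x) xy≈1)) (begin
    frob k y * x         ≈⟨ *-congˡ fx ⟨
    frob k y * frob k x  ≈⟨ frob-* k y x ⟨
    frob k (y * x)       ≈⟨ frob-cong k (trans (*-comm y x) xy≈1) ⟩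
    frob k 1#            ≈⟨ frob-1# k ⟩
    1#                   ≈⟨ trans (sym xy≈1) (*-comm x y) ⟩
    y * x                ∎)

  sumTo-cong : ∀ m {f g : ℕ → Carrier} → (∀ j → f j ≈ g j) → sumTo m f ≈ sumTo m g
  sumTo-cong zero    f≈g = refl
  sumTo-cong (suc m) f≈g = +-cong (sumTo-cong m f≈g) (f≈g m)

  sumTo-+ : ∀ m (f g : ℕ → Carrier) → sumTo m (λ j → f j + g j) ≈ sumTo m f + sumTo m g
  sumTo-+ zero    f g = sym (+-identityˡ 0#)
  sumTo-+ (suc m) f g = trans (+-congʳ (sumTo-+ m f g)) (interchange (sumTo m f) (sumTo m g) (f m) (g m))

  sumTo-*ˡ : ∀ m a (f : ℕ → Carrier) → sumTo m (λ j → a * f j) ≈ a * sumTo m f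
  sumTo-*ˡ zero    a f = sym (zeroʳ a)
  sumTo-*ˡ (suc m) a f = trans (+-congʳ (sumTo-*ˡ m a f)) (sym (distribˡ a (sumTo m f) (f m)))

  sumTo-shift : ∀ m (f : ℕ → Carrier) → sumTo m (λ j → f (suc j)) + f 0 ≈ sumTo m f + f m
  sumTo-shift zero    f = refl
  sumTo-shift (suc m) f = begin
    sumTo m (λ j → f (suc j)) + f (suc m) + f 0   ≈⟨ xy∙z≈xz∙y _ _ _ ⟩
    sumTo m (λ j → f (suc j)) + f 0 + f (suc m)   ≈⟨ +-congʳ (sumTo-shift m f) ⟩
    sumTo (suc m) f + f (suc m)                   ∎

  frob-sumTo : ∀ k m (f : ℕ → Carrier) → frob k (sumTo m f) ≈ sumTo m (λ j → frob k (f j))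
  frob-sumTo k zero    f = frob-0# k
  frob-sumTo k (suc m) f = trans (frob-+ k (sumTo m f) (f m)) (+-congʳ (frob-sumTo k m f))

  sparseMonic : ∀ D m (E : ℕ → ℕ) → (∀ {j} → j < m → E j < D) → Monic D
  sparseMonic D zero    E E<D = xᵈ D
  sparseMonic D (suc m) E E<D = addTerm 1# (E m) (E<D ℕ.≤-refl) (sparseMonic D m E (E<D ∘ ℕ.m≤n⇒m≤1+n))

  eval-sparseMonic : ∀ D m E (E<D : ∀ {j} → j < m → E j < D) x →
                     eval (sparseMonic D m E E<D) x ≈ pow x D + sumTo m (λ j → pow x (E j))
  eval-sparseMonic D zero    E E<D x = trans (eval-xᵈ D x) (sym (+-identityʳ _))
  eval-sparseMonic D (suc m) E E<D x = begin
    eval (sparseMonic D (suc m) E E<D) x                        ≈⟨ eval-addTerm 1# (E m) (E<D ℕ.≤-refl) _ x ⟩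
    eval (sparseMonic D m E _) x + 1# * pow x (E m)             ≈⟨ +-cong (eval-sparseMonic D m E _ x) (*-identityˡ _) ⟩
    pow x D + sumTo m (λ j → pow x (E j)) + pow x (E m)         ≈⟨ +-assoc _ _ _ ⟩
    pow x D + sumTo (suc m) (λ j → pow x (E j))                 ∎

  count-Fixed≤ : ∀ {k} → 1 ≤ k → count (Fixed? k) ≤ q ℕ.^ k
  count-Fixed≤ {k} 1≤k = count-roots≤degree x^qᵏ-x (Fixed? k) λ {x} fx → begin
    eval x^qᵏ-x x                            ≈⟨ eval-addTerm (- 1#) 1 (1<qᵏ 1≤k) (xᵈ (q ℕ.^ k)) x ⟩
    eval (xᵈ (q ℕ.^ k)) x + - 1# * (x * 1#)  ≈⟨ +-cong (trans (eval-xᵈ (q ℕ.^ k) x) fx)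
                                                        (trans (-1*x≈-x _) (-‿cong (*-identityʳ x))) ⟩
    x - x                                    ≈⟨ -‿inverseʳ x ⟩
    0#                                       ∎
    where
    x^qᵏ-x : Monic (q ℕ.^ k)
    x^qᵏ-x = addTerm (- 1#) 1 (1<qᵏ 1≤k) (xᵈ (q ℕ.^ k))

  module RelativeTrace {t m′ : ℕ} (1≤t : 1 ≤ t) (h≡t*[1+m′] : h ≡ t ℕ.* suc m′) where

    L : Carrier → Carrier
    L = relTrace t (suc m′)

    L-cong : ∀ {x y} → x ≈ y → L x ≈ L y
    L-cong x≈y = sumTo-cong (suc m′) (λ j → frob-cong (t ℕ.* j) x≈y)

    L-+ : ∀ x y → L (x + y) ≈ L x + L y
    L-+ x y = trans (sumTo-cong (suc m′) (λ j → frob-+ (t ℕ.* j) x y)) (sumTo-+ (suc m′) _ _)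

    -- frob t shifts the summands of L x cyclically, since frob (t (1 + m′)) = frob h is the identity.
    L-Fixed : ∀ x → Fixed t (L x)
    L-Fixed x = begin
      frob t (L x)                           ≈⟨ frob-sumTo t (suc m′) xᵗʲ ⟩
      sumTo (suc m′) (λ j → frob t (xᵗʲ j))  ≈⟨ sumTo-cong (suc m′) (λ j → trans (frob-frob t (t ℕ.* j) x)
                                                  (≡.subst (λ k → frob k x ≈ xᵗʲ (suc j)) (ℕ.*-suc t j) refl)) ⟩
      sumTo (suc m′) (λ j → xᵗʲ (suc j))     ≈⟨ ∙-cancelʳ (xᵗʲ 0) _ _
                                                  (trans (sumTo-shift (suc m′) xᵗʲ) (+-congˡ last≈first)) ⟩
      L x                                    ∎
      where
      xᵗʲ : ℕ → Carrier
      xᵗʲ j = frob (t ℕ.* j) x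
      last≈first : xᵗʲ (suc m′) ≈ xᵗʲ 0
      last≈first = ≡.subst₂ (λ a b → frob a x ≈ frob b x) h≡t*[1+m′] (≡.sym (ℕ.*-zeroʳ t))
                     (trans (frob-h x) (sym (frob-0 x)))

    L-*ˡ : ∀ {a} x → Fixed t a → L (a * x) ≈ a * L x
    L-*ˡ {a} x fa = trans (sumTo-cong (suc m′) (λ j → trans (frob-* (t ℕ.* j) a x) (*-congʳ (Fixed-tj j))))
                          (sumTo-*ˡ (suc m′) a (λ j → frob (t ℕ.* j) x))
      where
      Fixed-tj : ∀ j → Fixed (t ℕ.* j) a
      Fixed-tj j = ≡.subst (λ k → Fixed k a) (ℕ.*-comm j t) (Fixed-exp-* j fa)

    open AdditiveMap L L-cong L-+ using (fiber?; size≤count*count-kernel)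

    Kernel? : Decidable (λ x → L x ≈ 0#)
    Kernel? = fiber? 0#

    count-kernel≤ : count Kernel? ≤ q ℕ.^ (t ℕ.* m′)
    count-kernel≤ = count-roots≤degree tracePolynomial Kernel? λ {x} Lx≈0 → begin
      eval tracePolynomial x                                         ≈⟨ eval-sparseMonic _ m′ _ exponent< x ⟩
      pow x (q ℕ.^ (t ℕ.* m′)) + sumTo m′ (λ j → frob (t ℕ.* j) x)  ≈⟨ +-comm _ _ ⟩
      L x                                                            ≈⟨ Lx≈0 ⟩
      0#                                                             ∎
      where
      exponent< : ∀ {j} → j < m′ → q ℕ.^ (t ℕ.* j) < q ℕ.^ (t ℕ.* m′)
      exponent< j<m′ = ℕ.^-monoʳ-< q 1<q (ℕ.*-monoʳ-< t {{ℕ.>-nonZero 1≤t}} j<m′)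
      tracePolynomial : Monic (q ℕ.^ (t ℕ.* m′))
      tracePolynomial = sparseMonic _ m′ (λ j → q ℕ.^ (t ℕ.* j)) exponent<

    size≡qᵗ*qᵗᵐ′ : size ≡ q ℕ.^ t ℕ.* q ℕ.^ (t ℕ.* m′)
    size≡qᵗ*qᵗᵐ′ = ≡.trans size≡qʰ (≡.trans (≡.cong (q ℕ.^_) (≡.trans h≡t*[1+m′] (ℕ.*-suc t m′)))
                                           (ℕ.^-distribˡ-+-* q t (t ℕ.* m′)))

    qᵗ*qᵗᵐ′≤count-Fixed*count-kernel : q ℕ.^ t ℕ.* q ℕ.^ (t ℕ.* m′) ≤ count (Fixed? t) ℕ.* count Kernel?
    qᵗ*qᵗᵐ′≤count-Fixed*count-kernel = ≡.subst (_≤ count (Fixed? t) ℕ.* count Kernel?) size≡qᵗ*qᵗᵐ′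
      (size≤count*count-kernel (Fixed? t) (Fixed-resp t) L-Fixed)

    count-Fixed≡qᵗ : count (Fixed? t) ≡ q ℕ.^ t
    count-Fixed≡qᵗ = ℕ.≤-antisym (count-Fixed≤ 1≤t)
      (m*n≤o*p⇒p≤n⇒m≤o {{qᵏ-nonZero (t ℕ.* m′)}} qᵗ*qᵗᵐ′≤count-Fixed*count-kernel count-kernel≤)

    count-kernel≡qᵗᵐ′ : count Kernel? ≡ q ℕ.^ (t ℕ.* m′)
    count-kernel≡qᵗᵐ′ = ℕ.≤-antisym count-kernel≤
      (m*n≤o*p⇒p≤n⇒m≤o {{qᵏ-nonZero t}} (≡.subst₂ _≤_ (ℕ.*-comm (q ℕ.^ t) _) (ℕ.*-comm (count (Fixed? t)) _)
                                                  qᵗ*qᵗᵐ′≤count-Fixed*count-kernel) (count-Fixed≤ 1≤t))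

  frobℤ-exponent : ℤ → ℕ
  frobℤ-exponent (+ k)    = k
  frobℤ-exponent -[1+ k ] = h ℕ.* suc k ℕ.∸ suc k

  frobℤ≡frob : ∀ n x → frobℤ h n x ≡ frob (frobℤ-exponent n) x
  frobℤ≡frob (+ k)    x = ≡.refl
  frobℤ≡frob -[1+ k ] x = ≡.refl

  Fixed-frobℤ-exponent⇒Fixed-∣n∣ : 1 ≤ h → ∀ n {x} → Fixed (frobℤ-exponent n) x → Fixed ∣ n ∣ x
  Fixed-frobℤ-exponent⇒Fixed-∣n∣ 1≤h (+ k)    fx = fx
  Fixed-frobℤ-exponent⇒Fixed-∣n∣ 1≤h -[1+ k ] {x} fx =
    ≡.subst (λ j → Fixed j x) (ℕ.m∸[m∸n]≡n k+1≤h[k+1])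
      (Fixed-exp-∸ {h ℕ.* suc k} {h ℕ.* suc k ℕ.∸ suc k} Fixed-h[k+1] fx (ℕ.m∸n≤m (h ℕ.* suc k) (suc k)))
    where
    k+1≤h[k+1] : suc k ≤ h ℕ.* suc k
    k+1≤h[k+1] = ℕ.≤-trans (ℕ.≤-reflexive (≡.sym (ℕ.*-identityˡ (suc k)))) (ℕ.*-monoˡ-≤ (suc k) 1≤h)
    Fixed-h[k+1] : Fixed (h ℕ.* suc k) x
    Fixed-h[k+1] = ≡.subst (λ j → Fixed j x) (ℕ.*-comm (suc k) h) (Fixed-exp-* {h} (suc k) (frob-h x))

  InFq? : Decidable InFq
  InFq? x = pow x q ≟ x

  InFq-resp : InFq Respects _≈_
  InFq-resp x≈y xq≈x = trans (pow-cong q (sym x≈y)) (trans xq≈x x≈y)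

  count-InFq≡q : 1 ≤ h → count InFq? ≡ q
  count-InFq≡q 1≤h = ≡.trans (count-≡ InFq? (Fixed? 1) InFq-resp (Fixed-resp 1) InFq⇒Fixed-1 Fixed-1⇒InFq)
    (≡.trans (RelativeTrace.count-Fixed≡qᵗ {1} {ℕ.pred h} ℕ.≤-refl h≡1*[1+h-1]) (ℕ.^-identityʳ q))
    where
    h≡1*[1+h-1] : h ≡ 1 ℕ.* suc (ℕ.pred h)
    h≡1*[1+h-1] = ≡.trans (≡.sym (ℕ.suc-pred h {{ℕ.>-nonZero 1≤h}})) (≡.sym (ℕ.*-identityˡ _))

  module Club {t m′ : ℕ} (1≤t : 1 ≤ t) (h≡t*[1+m′] : h ≡ t ℕ.* suc m′) (1≤m′ : 1 ≤ m′)
              (s : ℕ) (f : Carrier → Carrier) (f≈frob∘L : ∀ x → f x ≈ frob s (RelativeTrace.L 1≤t h≡t*[1+m′] x))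
              (Fixed-s⇒Fixed-t⇒Fixed-1 : ∀ {x} → Fixed s x → Fixed t x → Fixed 1 x) where
    open RelativeTrace 1≤t h≡t*[1+m′]
    open import Data.Product using (_×_; proj₂)

    f-cong : ∀ {x y} → x ≈ y → f x ≈ f y
    f-cong {x} {y} x≈y = trans (f≈frob∘L x) (trans (frob-cong s (L-cong x≈y)) (sym (f≈frob∘L y)))

    L≈0⇒f≈0 : ∀ {x} → L x ≈ 0# → f x ≈ 0#
    L≈0⇒f≈0 {x} Lx≈0 = trans (f≈frob∘L x) (trans (frob-cong s Lx≈0) (frob-0# s))

    f≈0⇒L≈0 : ∀ {x} → f x ≈ 0# → L x ≈ 0#
    f≈0⇒L≈0 {x} fx≈0 = frob≈0#⇒≈0# s (trans (sym (f≈frob∘L x)) fx≈0)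

    f-Fixed : ∀ x → Fixed t (f x)
    f-Fixed x = Fixed-resp t (sym (f≈frob∘L x)) (Fixed-frob {t} s (L-Fixed x))

    f-*ˡ : ∀ {a} x → Fixed t a → f (a * x) ≈ frob s a * f x
    f-*ˡ {a} x fa = begin
      f (a * x)                ≈⟨ f≈frob∘L (a * x) ⟩
      frob s (L (a * x))       ≈⟨ frob-cong s (L-*ˡ x fa) ⟩
      frob s (a * L x)         ≈⟨ frob-* s a (L x) ⟩
      frob s a * frob s (L x)  ≈⟨ *-congˡ (f≈frob∘L x) ⟨
      frob s a * f x           ∎

    f-FqLinear : FqLinear f
    f-FqLinear = f-+ , λ a x a∈Fq → let a∈F₁ = InFq⇒Fixed-1 a∈Fq in
      trans (f-*ˡ x (Fixed-1⇒Fixed t a∈F₁)) (*-congʳ (Fixed-1⇒Fixed s a∈F₁))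
      where
      f-+ : ∀ x y → f (x + y) ≈ f x + f y
      f-+ x y = begin
        f (x + y)                      ≈⟨ f≈frob∘L (x + y) ⟩
        frob s (L (x + y))             ≈⟨ frob-cong s (L-+ x y) ⟩
        frob s (L x + L y)             ≈⟨ frob-+ s (L x) (L y) ⟩
        frob s (L x) + frob s (L y)    ≈⟨ +-cong (f≈frob∘L x) (f≈frob∘L y) ⟨
        f x + f y                      ∎

    Span : Carrier × Carrier → Carrier → Set (c ⊔ ℓ)
    Span (v₁ , v₂) x = Any (λ μ → f x ≈ μ * v₁ × x ≈ μ * v₂) elems

    Span? : ∀ v → Decidable (Span v)
    Span? v x = inSpan? (f x , x) v

    Span-resp : ∀ v → Span v Respects _≈_
    Span-resp v x≈y = Any.map (λ (fx≈ , x≈) → trans (f-cong (sym x≈y)) fx≈ , trans (sym x≈y) x≈)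

    span⁺ : ∀ {v₁ v₂ x} μ → f x ≈ μ * v₁ → x ≈ μ * v₂ → Span (v₁ , v₂) x
    span⁺ μ fx≈ x≈ = Any.map (λ μ≈μ′ → trans fx≈ (*-congʳ μ≈μ′) , trans x≈ (*-congʳ μ≈μ′)) (complete μ)

    weight-head : HasWeight f (0# , 1#) (t ℕ.* m′)
    weight-head = ≡.trans (count-≡ (Span? (0# , 1#)) Kernel? (Span-resp _) Kernel-resp Span⇒Kernel Kernel⇒Span)
                          count-kernel≡qᵗᵐ′
      where
      Kernel-resp : (λ x → L x ≈ 0#) Respects _≈_
      Kernel-resp x≈y Lx≈0 = trans (L-cong (sym x≈y)) Lx≈0
      Span⇒Kernel : ∀ {x} → Span (0# , 1#) x → L x ≈ 0#
      Span⇒Kernel sp with μ , fx≈μ0 , _ ← satisfied sp = f≈0⇒L≈0 (trans fx≈μ0 (zeroʳ μ))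
      Kernel⇒Span : ∀ {x} → L x ≈ 0# → Span (0# , 1#) x
      Kernel⇒Span {x} Lx≈0 = span⁺ x (trans (L≈0⇒f≈0 Lx≈0) (sym (zeroʳ x))) (sym (*-identityʳ x))

    1≤h : 1 ≤ h
    1≤h = ≡.subst (1 ≤_) (≡.sym h≡t*[1+m′]) (ℕ.*-mono-≤ 1≤t (s≤s z≤n))

    2≤count-kernel : 2 ≤ count Kernel?
    2≤count-kernel = ≡.subst (2 ≤_) (≡.sym count-kernel≡qᵗᵐ′) (1<qᵏ (ℕ.*-mono-≤ 1≤t 1≤m′))

    head-point : Σ Carrier λ x₀ → x₀ ≉ 0# × InSpan (f x₀ , x₀) (0# , 1#)
    head-point
      with x₀ , x₀≉0 , Lx₀≈0 ← Unique⇒2≤length⇒∃≉0 (Unique.filter⁺ setoid Kernel? distinct)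
                                                    2≤count-kernel (all-filter Kernel? elems)
      = x₀ , x₀≉0 , x₀ , trans (L≈0⇒f≈0 Lx₀≈0) (sym (zeroʳ x₀)) , sym (*-identityʳ x₀)

    -- f takes values in the subfield fixed by frob t, so μ = f (μ x) / f x lies there too;
    -- then L (μ x) = μ L x, and comparing with f (μ x) = μ f x shows that μ is also fixed by frob s.
    scalar⇒InFq : ∀ {x μ} → f x ≉ 0# → f (μ * x) ≈ μ * f x → InFq μ
    scalar⇒InFq {x} {μ} fx≉0 fμx≈μfx with fx⁻¹ , fx*fx⁻¹≈1 ← inverse (f x) fx≉0 =
      Fixed-1⇒InFq (Fixed-s⇒Fixed-t⇒Fixed-1 μ∈Fₛ μ∈Fₜ)
      where
      μ≈fμx*fx⁻¹ : μ ≈ f (μ * x) * fx⁻¹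
      μ≈fμx*fx⁻¹ = begin
        μ                     ≈⟨ *-identityʳ μ ⟨
        μ * 1#                ≈⟨ *-congˡ fx*fx⁻¹≈1 ⟨
        μ * (f x * fx⁻¹)      ≈⟨ *-assoc μ (f x) fx⁻¹ ⟨
        μ * f x * fx⁻¹        ≈⟨ *-congʳ fμx≈μfx ⟨
        f (μ * x) * fx⁻¹      ∎
      μ∈Fₜ : Fixed t μ
      μ∈Fₜ = Fixed-resp t (sym μ≈fμx*fx⁻¹)
               (Fixed-* {t} (f-Fixed (μ * x)) (Fixed-inverse {t} fx*fx⁻¹≈1 (f-Fixed x)))
      μ∈Fₛ : Fixed s μ
      μ∈Fₛ = *-cancelʳ-≉0 fx≉0 (trans (sym (f-*ˡ x μ∈Fₜ)) fμx≈μfx)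

    weight-other : ∀ x → x ≉ 0# → ¬ InSpan (f x , x) (0# , 1#) → HasWeight f (f x , x) 1
    weight-other x x≉0 x∉head with x⁻¹ , xx⁻¹≈1 ← inverse x x≉0 =
      ≡.trans (ℕ.≤-antisym Span≤Fq Fq≤Span) (≡.trans (count-InFq≡q 1≤h) (≡.sym (ℕ.^-identityʳ q)))
      where
      fx≉0 : f x ≉ 0#
      fx≉0 fx≈0 = x∉head (x , trans fx≈0 (sym (zeroʳ x)) , sym (*-identityʳ x))
      Span≤Fq : count (Span? (f x , x)) ≤ count InFq?
      Span≤Fq = count-≤ (Span? _) InFq? InFq-resp (_* x⁻¹) (*-cancelʳ-≉0 (x*y≈1⇒y≉0 xx⁻¹≈1)) λ {y} sp →
        let μ , fy≈μfx , y≈μx = satisfied sp in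
        InFq-resp (begin
          μ             ≈⟨ *-identityʳ μ ⟨
          μ * 1#        ≈⟨ *-congˡ xx⁻¹≈1 ⟨
          μ * (x * x⁻¹) ≈⟨ *-assoc μ x x⁻¹ ⟨
          μ * x * x⁻¹   ≈⟨ *-congʳ y≈μx ⟨
          y * x⁻¹       ∎)
          (scalar⇒InFq fx≉0 (trans (f-cong (sym y≈μx)) fy≈μfx))
      Fq≤Span : count InFq? ≤ count (Span? (f x , x))
      Fq≤Span = count-≤ InFq? (Span? _) (Span-resp _) (_* x) (*-cancelʳ-≉0 x≉0) λ {μ} μ∈Fq →
        span⁺ μ (proj₂ f-FqLinear μ x μ∈Fq) refl

    isClub : IsClub f (t ℕ.* m′) h
    isClub = f-FqLinear , size≡qʰ , (0# , 1#) , inj₂ 1≉0 , head-point , weight-head , weight-other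

open import Data.Nat using (_^_; _*_; _∸_)

theorem3p3 : ∀ {c ℓ : Level} (F : FiniteField c ℓ) (p e q h i m : ℕ) (n : ℤ)
    → Prime p → 1 ≤ e → q ≡ p ^ e
    → FiniteField.size F ≡ q ^ h
    → 1 ≤ i → i < h → h ≡ m * (h ∸ i)
    → gcd (h ∸ i) ∣ n ∣ ≡ 1
    → FieldOps.IsClub F q (λ x → FieldOps.frobℤ F q h n (FieldOps.relTrace F q (h ∸ i) m x)) i h
theorem3p3 F p e q h i zero n _ _ _ _ _ i<h h≡0 _ = contradiction (≡.subst (i <_) h≡0 i<h) ℕ.n≮0
theorem3p3 F p e q h i (suc m′) n p-prime 1≤e q≡pᵉ size≡qʰ 1≤i i<h h≡m*t gcd[t,n]≡1 =
  ≡.subst (λ k → IsClub f k h) (≡.sym i≡t*m′)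
    (Club.isClub 1≤t h≡t*[1+m′] 1≤m′ (frobℤ-exponent n) f f≈frob∘L Fixed-s⇒Fixed-t⇒Fixed-1)
  where
  open FiniteField F using (Carrier; _≈_; reflexive)
  open FieldOps F q using (IsClub; frob; frobℤ; relTrace)
  open Frobenius F {h = h} p-prime 1≤e q≡pᵉ size≡qʰ
  t : ℕ
  t = h ∸ i
  f : Carrier → Carrier
  f x = frobℤ h n (relTrace t (suc m′) x)
  f≈frob∘L : ∀ x → f x ≈ frob (frobℤ-exponent n) (relTrace t (suc m′) x)
  f≈frob∘L x = reflexive (frobℤ≡frob n _)
  1≤t : 1 ≤ t
  1≤t = ℕ.m<n⇒0<n∸m i<h
  h≡t*[1+m′] : h ≡ t * suc m′
  h≡t*[1+m′] = ≡.trans h≡m*t (ℕ.*-comm (suc m′) t)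
  i≡t*m′ : i ≡ t * m′
  i≡t*m′ = ≡.trans (≡.sym (ℕ.m∸[m∸n]≡n (ℕ.<⇒≤ i<h)))
             (≡.trans (≡.cong (_∸ t) (≡.trans h≡t*[1+m′] (ℕ.*-suc t m′))) (ℕ.m+n∸m≡n t (t * m′)))
  1≤m′ : 1 ≤ m′
  1≤m′ = ℕ.>-nonZero⁻¹ m′ {{ℕ.m*n≢0⇒n≢0 t {{ℕ.>-nonZero (≡.subst (1 ≤_) i≡t*m′ 1≤i)}}}}
  Fixed-s⇒Fixed-t⇒Fixed-1 : ∀ {x} → Fixed (frobℤ-exponent n) x → Fixed t x → Fixed 1 x
  Fixed-s⇒Fixed-t⇒Fixed-1 {x} fs ft = ≡.subst (λ k → Fixed k x) gcd[t,n]≡1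
    (Fixed-exp-gcd {t} {∣ n ∣} ft (Fixed-frobℤ-exponent⇒Fixed-∣n∣ (ℕ.≤-trans 1≤i (ℕ.<⇒≤ i<h)) n fs))
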